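{- Consider algorithm \textsf{A} (defined below) run on a connected undirected graph with vertex set $[n]$, $n\ge 2$. Let $v$ be a root with $v\neq 1$ (i.e., not the minimum vertex) that has no green children just before the \textsc{shortcut} in round $i$. Then the \textsc{connect} and \textsc{update} of round $i+1$ make $v$ a non-root.
   Context: Each edge $e$ has two ends $e.v,e.w$; the current edge set is initially the input edge set. Each vertex $v$ has a parent $v.p$, initially $v$; $v$ is a root if $v.p=v$, otherwise a child of $v.p$. Vertices are compared as integers. Each operation is performed simultaneously for all edges/vertices using values at the start of the operation. \textsc{connect}: for each current edge $e$, send $\min\{e.v,e.w\}$ to $\max\{e.v,e.w\}$. \textsc{update}: for each vertex $v$, replace $v.p$ by the minimum of $v.p$ and the vertices sent to $v$ in the preceding \textsc{connect}. \textsc{shortcut}: for each vertex $v$, replace $v.p$ by $(v.p).p$. \textsc{alter}: for each edge $e$, let $x=e.v.p$, $y=e.w.p$; replace $e.v,e.w$ by $x,y$ (the algorithm deletes the edge when $x=y$; for the analysis it is instead kept as the loop $(x,x)$, which does not affect parent changes). Algorithm \textsf{A}: repeat \{\textsc{connect}; \textsc{update}; \textsc{shortcut}; \textsc{alter}\} until no parent changes; iterations are rounds $1,2,\dots$. A vertex is green if it is a root or is an end of some current edge (loops included), and red otherwise. -}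

module Defs where

open import Data.Nat using (ℕ; zero; suc; _≤_; _<_)
open import Data.Fin using (Fin; toℕ)
open import Data.Fin.Properties using (_≟_; _≤?_)
open import Data.List using (List; foldr)
open import Data.List.Relation.Unary.Any using (Any)
open import Data.Product using (_×_; _,_; proj₁; proj₂; ∃)
open import Data.Sum using (_⊎_)
open import Relation.Nullary using (¬_; yes; no)
open import Relation.Binary.PropositionalEquality using (_≡_; _≢_)

-- Vertices are Fin n (order-preserving relabelling of [n] = {1,…,n}:
-- vertex k+1 of the paper is Fin element k).
-- An edge is an (unordered, represented as ordered) pair of ends (e.v , e.w).
Edge : ℕ → Set
Edge n = Fin n × Fin n

Parents : ℕ → Set
Parents n = Fin n → Fin n

minF : ∀ {n} → Fin n → Fin n → Fin n
minF a b with a ≤? b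
... | yes _ = a
... | no _  = b

maxF : ∀ {n} → Fin n → Fin n → Fin n
maxF a b with a ≤? b
... | yes _ = b
... | no _  = a

-- State of the algorithm: parents and current edge set (loops kept).
record State (n : ℕ) : Set where
  constructor st
  field
    par   : Parents n
    edges : List (Edge n)
open State public

Adj : ∀ {n} → List (Edge n) → Fin n → Fin n → Set
Adj E u w = Any (λ e → (proj₁ e ≡ u × proj₂ e ≡ w) ⊎ (proj₁ e ≡ w × proj₂ e ≡ u)) E

data Reach {n} (E : List (Edge n)) : Fin n → Fin n → Set where
  here : ∀ {u} → Reach E u u
  step : ∀ {u w x} → Adj E u w → Reach E w x → Reach E u x

Connected : ∀ {n} → List (Edge n) → Set
Connected {n} E = (u w : Fin n) → Reach E u w

-- CONNECT followed by UPDATE: each current edge e sends min{e.v,e.w} to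
-- max{e.v,e.w}; each vertex v gets v.p := min(v.p, all values sent to v).
-- contribution of edge e to vertex v: if max{e.v,e.w} = v then v receives
-- min{e.v,e.w}, combined with the running minimum acc
receive : ∀ {n} → Fin n → Edge n → Fin n → Fin n
receive v (a , b) acc with maxF a b ≟ v
... | yes _ = minF acc (minF a b)
... | no _  = acc

connectUpdate : ∀ {n} → List (Edge n) → Parents n → Parents n
connectUpdate E p v = foldr (receive v) (p v) E

shortcut : ∀ {n} → Parents n → Parents n
shortcut p v = p (p v)

alter : ∀ {n} → Parents n → List (Edge n) → List (Edge n)
alter p E = Data.List.map (λ e → (p (proj₁ e) , p (proj₂ e))) E

round : ∀ {n} → State n → State n
round (st p E) =
  let p₁ = connectUpdate E p
      p₂ = shortcut p₁
  in st p₂ (alter p₂ E)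

initial : ∀ {n} → List (Edge n) → State n
initial E = st (λ v → v) E

stateAfter : ∀ {n} → List (Edge n) → ℕ → State n
stateAfter E zero    = initial E
stateAfter E (suc k) = round (stateAfter E k)

-- Parents just before the SHORTCUT of round i (i ≥ 1), i.e. after
-- CONNECT and UPDATE of round i.
parBeforeShortcut : ∀ {n} → List (Edge n) → ℕ → Parents n
parBeforeShortcut E zero    = λ v → v   -- unused (rounds start at 1)
parBeforeShortcut E (suc k) =
  connectUpdate (edges (stateAfter E k)) (par (stateAfter E k))

-- Some parent changes in round j (j ≥ 1), so the algorithm does not stop
-- after round j.
ParentChangesIn : ∀ {n} → List (Edge n) → ℕ → Set
ParentChangesIn E zero    = Data.Unit.⊤ where import Data.Unit
ParentChangesIn {n} E (suc k) =
  ∃ λ (u : Fin n) → par (stateAfter E (suc k)) u ≢ par (stateAfter E k) u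

IsEnd : ∀ {n} → List (Edge n) → Fin n → Set
IsEnd E u = Any (λ e → proj₁ e ≡ u ⊎ proj₂ e ≡ u) E

Green : ∀ {n} → Parents n → List (Edge n) → Fin n → Set
Green p E u = p u ≡ u ⊎ IsEnd E u

-- Let p be the parents just before that SHORTCUT and F the current
-- edges.  Every input edge (a , b) appears in F as (rep a , rep b), where
-- rep is the composition of all earlier parent maps.  The set of input
-- vertices x with p (rep x) = v contains v but not the minimum vertex 1
-- (Fin.zero, a root forever), so by connectivity an input edge leaves it;
-- its image in F starts at a child of v that is an end of a current edge,
-- which must be v itself.  Hence v has a
-- current neighbour b outside its tree.  If b < v, v would already have
-- hooked onto b; so b > v, b hooked onto some p b < v, after SHORTCUT and
-- ALTER the edge becomes (v , p (p b)) with p (p b) < v, and in round i+1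
-- the root v receives p (p b) and gets a smaller parent.
module Submission where

open import Defs
open import Data.Nat using (ℕ; zero; suc; _∸_; z≤n)
import Data.Nat.Properties as ℕ
open import Data.Fin using (Fin; toℕ)
import Data.Fin as Fin
open import Data.Fin.Properties using (_≟_; _≤?_; ≤-refl; ≤-trans; ≤-antisym; <-cmp; <⇒≢; ≤∧≢⇒<)
open import Data.List using (List; []; _∷_)
open import Data.List.Relation.Unary.Any using (here; there)
import Data.List.Relation.Unary.Any as Any
open import Data.Product using (_×_; _,_; proj₁; proj₂; ∃-syntax)
open import Data.Sum using (_⊎_; inj₁; inj₂)
open import Data.Empty using (⊥-elim)
open import Relation.Nullary using (¬_; yes; no; Dec)
open import Relation.Binary using (tri<; tri≈; tri>)
open import Relation.Binary.PropositionalEquality using (_≡_; _≢_; refl; sym; trans; cong; subst)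

module _ {n : ℕ} where
  open Data.Fin using (_≤_; _<_)

  minF-≤ˡ : (a b : Fin n) → minF a b ≤ a
  minF-≤ˡ a b with a ≤? b
  ... | yes _   = ≤-refl
  ... | no  a≰b = ℕ.<⇒≤ (ℕ.≰⇒> a≰b)

  minF-≤ʳ : (a b : Fin n) → minF a b ≤ b
  minF-≤ʳ a b with a ≤? b
  ... | yes a≤b = a≤b
  ... | no  _   = ≤-refl

  Joins : Fin n → Fin n → Edge n → Set
  Joins u w e = (proj₁ e ≡ u × proj₂ e ≡ w) ⊎ (proj₁ e ≡ w × proj₂ e ≡ u)

  joins-ordered : ∀ {x c} (e : Edge n) → Joins x c e → c < x →
                  maxF (proj₁ e) (proj₂ e) ≡ x × minF (proj₁ e) (proj₂ e) ≡ c
  joins-ordered {x} {c} _ (inj₁ (refl , refl)) c<x with x ≤? c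
  ... | yes x≤c = ⊥-elim (ℕ.<⇒≱ c<x x≤c)
  ... | no  _   = refl , refl
  joins-ordered {x} {c} _ (inj₂ (refl , refl)) c<x with c ≤? x
  ... | yes _   = refl , refl
  ... | no  c≰x = ⊥-elim (c≰x (ℕ.<⇒≤ c<x))

  receive-≤ : ∀ x (e : Edge n) acc → receive x e acc ≤ acc
  receive-≤ x (a , b) acc with maxF a b ≟ x
  ... | yes _ = minF-≤ˡ acc (minF a b)
  ... | no  _ = ≤-refl

  receive-sent : ∀ {x c} (e : Edge n) acc → Joins x c e → c < x → receive x e acc ≤ c
  receive-sent {x} (a , b) acc j c<x with joins-ordered (a , b) j c<x
  ... | max≡x , min≡c with maxF a b ≟ x
  ...   | yes _   = subst (minF acc (minF a b) ≤_) min≡c (minF-≤ʳ acc (minF a b))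
  ...   | no  max≢x = ⊥-elim (max≢x max≡x)

  connectUpdate-≤ : (F : List (Edge n)) (P : Parents n) (x : Fin n) → connectUpdate F P x ≤ P x
  connectUpdate-≤ []      P x = ≤-refl
  connectUpdate-≤ (e ∷ F) P x = ≤-trans (receive-≤ x e _) (connectUpdate-≤ F P x)

  connectUpdate-receives : (F : List (Edge n)) (P : Parents n) {x c : Fin n} →
                           Adj F x c → c < x → connectUpdate F P x ≤ c
  connectUpdate-receives (e ∷ F) P (here j)   c<x = receive-sent e _ j c<x
  connectUpdate-receives (e ∷ F) P (there xc) c<x =
    ≤-trans (receive-≤ _ e _) (connectUpdate-receives F P xc c<x)

  Decreasing : Parents n → Set
  Decreasing P = ∀ x → P x ≤ x

  connectUpdate-decreasing : (F : List (Edge n)) {P : Parents n} →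
                             Decreasing P → Decreasing (connectUpdate F P)
  connectUpdate-decreasing F {P} dec x = ≤-trans (connectUpdate-≤ F P x) (dec x)

  shortcut-decreasing : {P : Parents n} → Decreasing P → Decreasing (shortcut P)
  shortcut-decreasing {P} dec x = ≤-trans (dec (P x)) (dec x)

  root-if-not-below : {P : Parents n} → Decreasing P → ∀ {x} → x ≤ P x → P x ≡ x
  root-if-not-below dec {x} x≤Px = ≤-antisym (dec x) x≤Px

  root-before-update : (F : List (Edge n)) {P : Parents n} → Decreasing P →
                       ∀ {x} → connectUpdate F P x ≡ x → P x ≡ x
  root-before-update F {P} dec {x} eq =
    root-if-not-below dec (subst (_≤ P x) eq (connectUpdate-≤ F P x))

  root-before-shortcut : {P : Parents n} → Decreasing P → ∀ {x} → shortcut P x ≡ x → P x ≡ x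
  root-before-shortcut {P} dec {x} eq =
    root-if-not-below dec (subst (_≤ P x) eq (dec (P x)))

  Adj-sym : ∀ {F : List (Edge n)} {u w} → Adj F u w → Adj F w u
  Adj-sym = Any.map λ { (inj₁ uw) → inj₂ uw ; (inj₂ wu) → inj₁ wu }

  Adj-end : ∀ {F : List (Edge n)} {u w} → Adj F u w → IsEnd F u
  Adj-end = Any.map λ { (inj₁ (a≡u , _)) → inj₁ a≡u ; (inj₂ (_ , b≡u)) → inj₂ b≡u }

  Adj-alter : (f : Parents n) (F : List (Edge n)) {u w : Fin n} →
              Adj F u w → Adj (alter f F) (f u) (f w)
  Adj-alter f (e ∷ F) (here (inj₁ (a≡u , b≡w))) = here (inj₁ (cong f a≡u , cong f b≡w))
  Adj-alter f (e ∷ F) (here (inj₂ (a≡w , b≡u))) = here (inj₂ (cong f a≡w , cong f b≡u))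
  Adj-alter f (e ∷ F) (there uw)                 = there (Adj-alter f F uw)

  crossing-edge : (E : List (Edge n)) (W : Fin n → Set) → (∀ x → Dec (W x)) →
                  ∀ {u w} → Reach E u w → W u → ¬ W w →
                  ∃[ a ] ∃[ b ] Adj E a b × W a × ¬ W b
  crossing-edge E W W? here                 Wu ¬Ww = ⊥-elim (¬Ww Wu)
  crossing-edge E W W? {u} (step {w = y} uy path) Wu ¬Ww with W? y
  ... | yes Wy = crossing-edge E W W? path Wy ¬Ww
  ... | no ¬Wy = u , y , uy , Wu , ¬Wy

  root-absorbed : (s : State n) → Decreasing (par s) → ∀ {v b} →
                  connectUpdate (edges s) (par s) v ≡ v →
                  Adj (edges s) v b →
                  connectUpdate (edges s) (par s) b ≢ v →
                  connectUpdate (edges (round s)) (par (round s)) v < v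
  root-absorbed (st P F) dec {v} {b} pv≡v v~b pb≢v with <-cmp b v
  ... | tri< b<v _ _ =
    ⊥-elim (ℕ.<⇒≱ b<v (subst (_≤ b) pv≡v (connectUpdate-receives F P v~b b<v)))
  ... | tri≈ _ b≡v _ = ⊥-elim (pb≢v (trans (cong p b≡v) pv≡v))
    where
    p : Parents n
    p = connectUpdate F P
  ... | tri> _ _ v<b =
    ℕ.≤-<-trans (connectUpdate-receives (alter q F) q v~qb qb<v) qb<v
    where
    p q : Parents n
    p = connectUpdate F P
    q = shortcut p
    -- b hooked onto v or lower, and not onto v itself
    pb<v : p b < v
    pb<v = ≤∧≢⇒< (connectUpdate-receives F P (Adj-sym v~b) v<b) pb≢v
    qb<v : q b < v
    qb<v = ℕ.≤-<-trans (connectUpdate-decreasing F dec (p b)) pb<v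
    v~qb : Adj (alter q F) v (q b)
    v~qb = subst (λ y → Adj (alter q F) y (q b)) (trans (cong p pv≡v) pv≡v)
                 (Adj-alter q F v~b)

module Run {n : ℕ} (E : List (Edge n)) where

  state : ℕ → State n
  state = stateAfter E

  -- rep k x: where the input vertex x has been moved by the ALTERs of rounds 1..k.
  rep : ℕ → Fin n → Fin n
  rep zero    x = x
  rep (suc k) x = par (state (suc k)) (rep k x)

  parents-decreasing : ∀ k → Decreasing (par (state k))
  parents-decreasing zero    x = ≤-refl
  parents-decreasing (suc k) =
    shortcut-decreasing (connectUpdate-decreasing (edges (state k)) (parents-decreasing k))

  edge-image : ∀ k {a b} → Adj E a b → Adj (edges (state k)) (rep k a) (rep k b)
  edge-image zero    ab = ab
  edge-image (suc k) ab =
    Adj-alter (par (state (suc k))) (edges (state k)) (edge-image k ab)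

  root-persists-backwards : ∀ k {x} → par (state (suc k)) x ≡ x → par (state k) x ≡ x
  root-persists-backwards k qx≡x =
    root-before-update (edges (state k)) (parents-decreasing k)
      (root-before-shortcut (connectUpdate-decreasing (edges (state k)) (parents-decreasing k)) qx≡x)

  rep-root : ∀ k {x} → par (state k) x ≡ x → rep k x ≡ x
  rep-root zero    _     = refl
  rep-root (suc k) Px≡x =
    trans (cong (par (state (suc k))) (rep-root k (root-persists-backwards k Px≡x))) Px≡x

decreasing-zero : ∀ {m} {P : Parents (suc m)} → Decreasing P → P Fin.zero ≡ Fin.zero
decreasing-zero dec = root-if-not-below dec z≤n

escape-edge : ∀ {m} (E : List (Edge (suc m))) → Connected E → ∀ k (v : Fin (suc m)) →
              toℕ v ≢ 0 →
              parBeforeShortcut E (suc k) v ≡ v →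
              (∀ u → u ≢ v → parBeforeShortcut E (suc k) u ≡ v →
                 ¬ Green (parBeforeShortcut E (suc k)) (edges (stateAfter E k)) u) →
              ∃[ b ] Adj (edges (stateAfter E k)) v b × parBeforeShortcut E (suc k) b ≢ v
escape-edge {m} E connected k v v≢1 pv≡v noGreenChild =
  leave (crossing-edge E InTree (λ x → p (rep k x) ≟ v) (connected v Fin.zero) v∈tree 1∉tree)
  where
  open Run E
  F : List (Edge (suc m))
  F = edges (state k)
  p : Parents (suc m)
  p = parBeforeShortcut E (suc k)

  InTree : Fin (suc m) → Set
  InTree x = p (rep k x) ≡ v

  v∈tree : InTree v
  v∈tree = trans (cong p (rep-root k (root-before-update F (parents-decreasing k) pv≡v))) pv≡v

  p-rep-zero : p (rep k Fin.zero) ≡ Fin.zero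
  p-rep-zero = trans (cong p (rep-root k (decreasing-zero (parents-decreasing k))))
                     (decreasing-zero (connectUpdate-decreasing F (parents-decreasing k)))

  1∉tree : ¬ InTree Fin.zero
  1∉tree in-tree = v≢1 (cong toℕ (sym (trans (sym p-rep-zero) in-tree)))

  leave : (∃[ a ] ∃[ b ] Adj E a b × InTree a × ¬ InTree b) → ∃[ b ] Adj F v b × p b ≢ v
  leave (a , b , a~b , a∈tree , b∉tree) = rep k b , v~b , b∉tree
    where
    a~b' : Adj F (rep k a) (rep k b)
    a~b' = edge-image k a~b
    -- the current image of a is a child of v and an end of an edge, so it is v
    repa≡v : rep k a ≡ v
    repa≡v with rep k a ≟ v
    ... | yes eq = eq
    ... | no  ne = ⊥-elim (noGreenChild (rep k a) ne a∈tree (inj₂ (Adj-end a~b')))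
    v~b : Adj F v (rep k b)
    v~b = subst (λ y → Adj F y (rep k b)) repa≡v a~b'

-- The theorem; its order hypotheses are on ℕ.
open Data.Nat using (_≤_)

lemma14 : (n : ℕ) → 2 ≤ n → (E : List (Edge n)) → Connected E →
    (i : ℕ) → 1 ≤ i →
    ((j : ℕ) → 1 ≤ j → j ≤ i → ParentChangesIn E j) →
    (v : Fin n) → toℕ v ≢ 0 →
    parBeforeShortcut E i v ≡ v →
    ((u : Fin n) → u ≢ v → parBeforeShortcut E i u ≡ v →
    ¬ Green (parBeforeShortcut E i) (edges (stateAfter E (i ∸ 1))) u) →
    connectUpdate (edges (stateAfter E i)) (par (stateAfter E i)) v ≢ v
lemma14 zero    ()
lemma14 (suc m) _ E connected zero    ()
lemma14 (suc m) _ E connected (suc k) _ _ v v≢1 pv≡v noGreenChild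
  with escape-edge E connected k v v≢1 pv≡v noGreenChild
... | b , v~b , pb≢v =
  <⇒≢ (root-absorbed (stateAfter E k) (Run.parents-decreasing E k) pv≡v v~b pb≢v)
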